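{- Let $D=(F,T)\in\mathcal D_k$ and let $H$ be a graph. Then $$\mathrm{pi\text{ - }hom}(D,H)=\sum_{\substack{G\supseteq F,\ V(G)=V(F),\\ (G,T)\in\mathcal D_k}}\mathrm{pp\text{ - }hom}((G,T),H).$$
   Context: Graphs are finite, undirected, vertex-coloured triples $(V(G),E(G),\gamma^G)$. $G\supseteq F$ means $F$ is a subgraph of $G$: $V(F)\subseteq V(G)$, $E(F)\subseteq E(G)$, and the colourings agree on $V(F)$. A homomorphism preserves edges and colours. A tree is a finite poset $(V(T),\preceq)$ with a unique minimal element in which each $\{u:u\preceq t\}$ is a chain; height = maximum number of elements in a chain. An elimination tree of a graph $F$ is a tree on $V(F)$ with $u\preceq v$ or $v\preceq u$ for every edge $uv$. $\mathcal D_k$ is the class of pairs $(F,T)$ with $F$ a graph and $T$ an elimination tree of $F$ of height at most $k$. A homomorphism $h:(F,T)\to H$ (homomorphism $F\to H$) is past-injective if $h(u)\ne h(v)$ whenever $u\prec^T v$; it is past-preserving if moreover for all $u\preceq^T v$: $uv\in E(F)\iff h(u)h(v)\in E(H)$. $\mathrm{pi\text{ - }hom}$ and $\mathrm{pp\text{ - }hom}$ count past-injective and past-preserving homomorphisms. -}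

module Defs where

open import Data.Nat using (ℕ; _≤_)
import Data.Nat as ℕ
open import Data.Bool using (Bool; true; false)
import Data.Bool as 𝔹
open import Data.Fin using (Fin; _≟_)
open import Data.Fin.Properties using (all?; any?)
open import Data.Fin.Subset using (Subset; _∈_; ∣_∣)
open import Data.Fin.Subset.Properties using (_∈?_; anySubset?)
open import Data.List using (List; []; _∷_; [_]; map; concatMap; filter; length; allFin)
open import Data.Nat.ListAction using (sum)
open import Data.Product using (Σ; _×_; _,_; ∃)
open import Data.Sum using (_⊎_)
open import Relation.Binary.PropositionalEquality using (_≡_; _≢_)
open import Relation.Nullary using (Dec; ¬_; yes; no)
open import Relation.Nullary.Decidable using (map′; decidable-stable; ¬?; _×-dec_; _⊎-dec_; _→-dec_)
open import Relation.Unary using (Decidable)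
import Data.Vec.Functional as VF

-- all functions Fin n → A whose values lie in the list xs
-- (if xs enumerates A without repetition, this enumerates Fin n → A
--  without repetition, up to pointwise equality)
allFuns : ∀ {a} {A : Set a} (n : ℕ) → List A → List (Fin n → A)
allFuns ℕ.zero    xs = [ (λ ()) ]
allFuns (ℕ.suc n) xs = concatMap (λ x → map (λ f → x VF.∷ f) (allFuns n xs)) xs

count : ∀ {a p} {A : Set a} {P : A → Set p} → Decidable P → List A → ℕ
count P? xs = length (filter P? xs)

record Graph : Set where
  constructor mkGraph
  field
    size   : ℕ
    adj    : Fin size → Fin size → Bool
    colour : Fin size → ℕ
open Graph public

Edge : (G : Graph) → Fin (size G) → Fin (size G) → Set
Edge G u v = adj G u v ≡ true

IsGraph : Graph → Set
IsGraph G = (∀ u v → adj G u v ≡ adj G v u) × (∀ u → adj G u u ≡ false)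

Rel : ℕ → Set
Rel n = Fin n → Fin n → Bool

_⊢_⪯_ : ∀ {n} → Rel n → Fin n → Fin n → Set
T ⊢ u ⪯ v = T u v ≡ true

_⊢_≺_ : ∀ {n} → Rel n → Fin n → Fin n → Set
T ⊢ u ≺ v = (T ⊢ u ⪯ v) × (u ≢ v)

Minimal : ∀ {n} → Rel n → Fin n → Set
Minimal T r = ∀ u → T ⊢ u ⪯ r → u ≡ r

IsTree : ∀ {n} → Rel n → Set
IsTree {n} T =
    (∀ u → T ⊢ u ⪯ u)
  × (∀ u v → T ⊢ u ⪯ v → T ⊢ v ⪯ u → u ≡ v)
  × (∀ u v w → T ⊢ u ⪯ v → T ⊢ v ⪯ w → T ⊢ u ⪯ w)
  × (Σ (Fin n) λ r → Minimal T r × (∀ s → Minimal T s → s ≡ r))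
  × (∀ t u v → T ⊢ u ⪯ t → T ⊢ v ⪯ t → (T ⊢ u ⪯ v) ⊎ (T ⊢ v ⪯ u))

IsChain : ∀ {n} → Rel n → Subset n → Set
IsChain T S = ∀ u v → u ∈ S → v ∈ S → (T ⊢ u ⪯ v) ⊎ (T ⊢ v ⪯ u)

HeightAtMost : ∀ {n} → ℕ → Rel n → Set
HeightAtMost k T = ∀ S → IsChain T S → ∣ S ∣ ≤ k

IsEliminationTree : (F : Graph) → Rel (size F) → Set
IsEliminationTree F T =
  IsTree T × (∀ u v → Edge F u v → (T ⊢ u ⪯ v) ⊎ (T ⊢ v ⪯ u))

InD : ℕ → (F : Graph) → Rel (size F) → Set
InD k F T = IsEliminationTree F T × HeightAtMost k T

IsHom : (F H : Graph) → (Fin (size F) → Fin (size H)) → Set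
IsHom F H h =
    (∀ u v → Edge F u v → Edge H (h u) (h v))
  × (∀ u → colour H (h u) ≡ colour F u)

IsPastInjective : (F : Graph) → Rel (size F) → (H : Graph) →
                  (Fin (size F) → Fin (size H)) → Set
IsPastInjective F T H h = IsHom F H h × (∀ u v → T ⊢ u ≺ v → h u ≢ h v)

IsPastPreserving : (F : Graph) → Rel (size F) → (H : Graph) →
                   (Fin (size F) → Fin (size H)) → Set
IsPastPreserving F T H h =
  IsPastInjective F T H h × (∀ u v → T ⊢ u ⪯ v → (Edge F u v → Edge H (h u) (h v)) × (Edge H (h u) (h v) → Edge F u v))

private
  allSubset? : ∀ {n p} {P : Subset n → Set p} → Decidable P → Dec (∀ S → P S)
  allSubset? P? = map′ (λ ¬∃ S → decidable-stable (P? S) (λ ¬p → ¬∃ (S , ¬p)))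
                       (λ ∀p (S , ¬p) → ¬p (∀p S))
                       (¬? (anySubset? (λ S → ¬? (P? S))))

  _≟𝔹_ = 𝔹._≟_
  _≟ℕ_ = ℕ._≟_

  ⪯? : ∀ {n} (T : Rel n) u v → Dec (T ⊢ u ⪯ v)
  ⪯? T u v = T u v ≟𝔹 true

  comp? : ∀ {n} (T : Rel n) u v → Dec ((T ⊢ u ⪯ v) ⊎ (T ⊢ v ⪯ u))
  comp? T u v = ⪯? T u v ⊎-dec ⪯? T v u

  minimal? : ∀ {n} (T : Rel n) r → Dec (Minimal T r)
  minimal? T r = all? λ u → ⪯? T u r →-dec (u ≟ r)

isGraph? : ∀ G → Dec (IsGraph G)
isGraph? G = all? (λ u → all? λ v → adj G u v ≟𝔹 adj G v u)
      ×-dec all? (λ u → adj G u u ≟𝔹 false)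

isTree? : ∀ {n} (T : Rel n) → Dec (IsTree T)
isTree? T =
        all? (λ u → ⪯? T u u)
  ×-dec all? (λ u → all? λ v → ⪯? T u v →-dec ⪯? T v u →-dec (u ≟ v))
  ×-dec all? (λ u → all? λ v → all? λ w → ⪯? T u v →-dec ⪯? T v w →-dec ⪯? T u w)
  ×-dec any? (λ r → minimal? T r ×-dec all? λ s → minimal? T s →-dec (s ≟ r))
  ×-dec all? (λ t → all? λ u → all? λ v → ⪯? T u t →-dec ⪯? T v t →-dec comp? T u v)

inD? : ∀ k F T → Dec (InD k F T)
inD? k F T =
  (isTree? T ×-dec all? (λ u → all? λ v → (adj F u v ≟𝔹 true) →-dec comp? T u v))
  ×-dec allSubset? (λ S → (all? λ u → all? λ v → (u ∈? S) →-dec (v ∈? S) →-dec comp? T u v)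
                          →-dec (∣ S ∣ ℕ.≤? k))

isHom? : ∀ F H h → Dec (IsHom F H h)
isHom? F H h = all? (λ u → all? λ v → (adj F u v ≟𝔹 true) →-dec (adj H (h u) (h v) ≟𝔹 true))
         ×-dec all? (λ u → colour H (h u) ≟ℕ colour F u)

isPastInjective? : ∀ F T H h → Dec (IsPastInjective F T H h)
isPastInjective? F T H h =
  isHom? F H h ×-dec all? (λ u → all? λ v → (⪯? T u v ×-dec ¬? (u ≟ v)) →-dec ¬? (h u ≟ h v))

isPastPreserving? : ∀ F T H h → Dec (IsPastPreserving F T H h)
isPastPreserving? F T H h =
  isPastInjective? F T H h ×-dec
  all? (λ u → all? λ v → ⪯? T u v →-dec
         (((adj F u v ≟𝔹 true) →-dec (adj H (h u) (h v) ≟𝔹 true))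
          ×-dec ((adj H (h u) (h v) ≟𝔹 true) →-dec (adj F u v ≟𝔹 true))))

maps : (F H : Graph) → List (Fin (size F) → Fin (size H))
maps F H = allFuns (size F) (allFin (size H))

pi-hom : (F : Graph) → Rel (size F) → (H : Graph) → ℕ
pi-hom F T H = count (isPastInjective? F T H) (maps F H)

pp-hom : (F : Graph) → Rel (size F) → (H : Graph) → ℕ
pp-hom F T H = count (isPastPreserving? F T H) (maps F H)

withEdges : (F : Graph) → Rel (size F) → Graph
withEdges F E = mkGraph (size F) E (colour F)

adjacencies : (F : Graph) → List (Rel (size F))
adjacencies F = allFuns (size F) (allFuns (size F) (true ∷ false ∷ []))

SupergraphInD : ℕ → (F : Graph) → Rel (size F) → Rel (size F) → Set
SupergraphInD k F T E =
  IsGraph (withEdges F E) × (∀ u v → Edge F u v → Edge (withEdges F E) u v) × InD k (withEdges F E) T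

supergraphInD? : ∀ k F T → Decidable (SupergraphInD k F T)
supergraphInD? k F T E =
  isGraph? (withEdges F E)
  ×-dec all? (λ u → all? λ v → (adj F u v ≟𝔹 true) →-dec (E u v ≟𝔹 true))
  ×-dec inD? k (withEdges F E) T

sumOverSupergraphs : ℕ → (F : Graph) → Rel (size F) → (H : Graph) → ℕ
sumOverSupergraphs k F T H =
  sum (map (λ E → pp-hom (withEdges F E) T H) (filter (supergraphInD? k F T) (adjacencies F)))

-- A past-preserving h on a supergraph G ⊇ F with V(G) = V(F) determines G: two vertices are
-- adjacent in G exactly when they are T-comparable (G has elimination tree T) and their images
-- are adjacent in H (h preserves the past). Conversely, for a past-injective h this recipe gives a
-- graph G ⊇ F with (G , T) ∈ 𝒟ₖ, on which h is past-preserving. So, after exchanging the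
-- summations over G and over h, every past-injective h is counted exactly once.
module Submission where

open import Defs
open import Data.Nat using (ℕ; _+_)
open import Relation.Binary.PropositionalEquality using (_≡_)

open import Algebra.Properties.CommutativeSemigroup using (interchange)
open import Data.Bool using (Bool; true; false; _∧_; _∨_; if_then_else_)
open import Data.Bool.Properties using (∨-comm; ∧-zeroʳ)
open import Data.Empty using (⊥-elim)
open import Data.Fin using (Fin; zero; suc)
open import Data.List using (List; []; _∷_; map; filter; length; concatMap; _++_)
open import Data.List.Properties using (length-++; filter-++; filter-none; map-cong; map-∘)
import Data.List.Relation.Unary.All as All
import Data.Nat as ℕ
open import Data.Nat.ListAction using (sum)
open import Data.Nat.Properties using (+-commutativeSemigroup)
open import Data.Product using (_×_; _,_; proj₁; proj₂)
open import Data.Sum using (_⊎_; inj₁; inj₂)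
open import Data.Vec.Functional as VF using (Vector; head; tail)
open import Data.Vec.Functional.Relation.Binary.Pointwise using (Pointwise)
open import Function using (_∘_)
open import Level using (Level; 0ℓ)
open import Relation.Binary.Definitions using (Reflexive)
open import Relation.Binary.PropositionalEquality
  using (refl; sym; trans; cong; cong₂; module ≡-Reasoning)
open import Relation.Nullary using (Dec; yes; no; ¬_; does)
open import Relation.Nullary.Decidable using (_×-dec_)
open import Relation.Unary using (Pred; Decidable)

private
  variable
    a b p q : Level
    A : Set a
    B : Set b

indicator : {P : Set p} → Dec P → ℕ
indicator P? = if does P? then 1 else 0

count≡sum-indicator : {P : Pred A p} (P? : Decidable P) →
                      ∀ xs → count P? xs ≡ sum (map (indicator ∘ P?) xs)
count≡sum-indicator P? []       = refl
count≡sum-indicator P? (x ∷ xs) with does (P? x)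
... | true  = cong (1 +_) (count≡sum-indicator P? xs)
... | false = count≡sum-indicator P? xs

module _ {P : Pred A p} (P? : Decidable P) where

  count-none : (∀ x → ¬ P x) → ∀ xs → count P? xs ≡ 0
  count-none ¬P xs = cong length (filter-none P? (All.universal ¬P xs))

  count-++ : ∀ xs ys → count P? (xs ++ ys) ≡ count P? xs + count P? ys
  count-++ xs ys = trans (cong length (filter-++ P? xs ys)) (length-++ (filter P? xs))

  count-concatMap : (g : B → List A) → ∀ xs →
                    count P? (concatMap g xs) ≡ sum (map (count P? ∘ g) xs)
  count-concatMap g []       = refl
  count-concatMap g (x ∷ xs) =
    trans (count-++ (g x) (concatMap g xs)) (cong (count P? (g x) +_) (count-concatMap g xs))

  count-map : (f : B → A) → ∀ xs → count P? (map f xs) ≡ count (P? ∘ f) xs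
  count-map f xs = begin
    count P? (map f xs)                   ≡⟨ count≡sum-indicator P? (map f xs) ⟩
    sum (map (indicator ∘ P?) (map f xs)) ≡⟨ cong sum (map-∘ xs) ⟨
    sum (map (indicator ∘ P? ∘ f) xs)     ≡⟨ count≡sum-indicator (P? ∘ f) xs ⟨
    count (P? ∘ f) xs                     ∎
    where open ≡-Reasoning

sum-map-zero : (xs : List A) → sum (map (λ _ → 0) xs) ≡ 0
sum-map-zero []       = refl
sum-map-zero (x ∷ xs) = sum-map-zero xs

sum-map-+ : (f g : A → ℕ) → ∀ xs →
            sum (map (λ x → f x + g x) xs) ≡ sum (map f xs) + sum (map g xs)
sum-map-+ f g []       = refl
sum-map-+ f g (x ∷ xs) = trans (cong (f x + g x +_) (sum-map-+ f g xs))
                               (interchange +-commutativeSemigroup (f x) (g x) _ _)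

sum-map-swap : (f : A → B → ℕ) → ∀ xs ys →
               sum (map (λ x → sum (map (f x) ys)) xs)
               ≡ sum (map (λ y → sum (map (λ x → f x y) xs)) ys)
sum-map-swap f []       ys = sym (sum-map-zero ys)
sum-map-swap f (x ∷ xs) ys =
  trans (cong (sum (map (f x) ys) +_) (sum-map-swap f xs ys))
        (sym (sum-map-+ (f x) (λ y → sum (map (λ x → f x y) xs)) ys))

sum-map-filter : {S : Pred A p} (S? : Decidable S) (f : A → ℕ) → ∀ xs →
                 sum (map f (filter S? xs)) ≡ sum (map (λ x → if does (S? x) then f x else 0) xs)
sum-map-filter S? f []       = refl
sum-map-filter S? f (x ∷ xs) with does (S? x)
... | true  = cong (f x +_) (sum-map-filter S? f xs)
... | false = sum-map-filter S? f xs

-- Counts the pairs (x , y) with S x and R x y in two ways.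
sum-count-filter : {S : Pred A p} (S? : Decidable S)
                   {R : A → Pred B q} (R? : ∀ x → Decidable (R x)) →
                   ∀ xs ys → sum (map (λ x → count (R? x) ys) (filter S? xs))
                             ≡ sum (map (λ y → count (λ x → S? x ×-dec R? x y) xs) ys)
sum-count-filter S? R? xs ys = begin
  sum (map (λ x → count (R? x) ys) (filter S? xs))
    ≡⟨ sum-map-filter S? (λ x → count (R? x) ys) xs ⟩
  sum (map (λ x → if does (S? x) then count (R? x) ys else 0) xs)
    ≡⟨ cong sum (map-cong guarded-count xs) ⟩
  sum (map (λ x → sum (map (λ y → indicator (S? x ×-dec R? x y)) ys)) xs)
    ≡⟨ sum-map-swap (λ x y → indicator (S? x ×-dec R? x y)) xs ys ⟩
  sum (map (λ y → sum (map (λ x → indicator (S? x ×-dec R? x y)) xs)) ys)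
    ≡⟨ cong sum (map-cong (λ y → count≡sum-indicator (λ x → S? x ×-dec R? x y) xs) ys) ⟨
  sum (map (λ y → count (λ x → S? x ×-dec R? x y) xs) ys) ∎
  where
  open ≡-Reasoning
  guarded-count : ∀ x → (if does (S? x) then count (R? x) ys else 0)
                        ≡ sum (map (λ y → indicator (S? x ×-dec R? x y)) ys)
  guarded-count x with S? x
  ... | yes _ = count≡sum-indicator (R? x) ys
  ... | no  _ = sym (sum-map-zero ys)

-- xs lists every ≈-class exactly once. Classes are presented by decidable predicates, since ≈
-- need not be decidable; for functions ≈ is pointwise equality, as there is no function
-- extensionality.
EnumeratesOnce : {A : Set} → (A → A → Set) → List A → Set₁
EnumeratesOnce {A} _≈_ xs =
  ∀ {Q : Pred A 0ℓ} (Q? : Decidable Q) a →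
  (∀ x → Q x → x ≈ a) → (∀ x → x ≈ a → Q x) → count Q? xs ≡ 1

count-singleton : {Q : Pred A p} (Q? : Decidable Q) {x : A} → Q x → count Q? (x ∷ []) ≡ 1
count-singleton Q? {x} qx with Q? x
... | yes _  = refl
... | no ¬qx = ⊥-elim (¬qx qx)

module _ {A : Set} {_≈_ : A → A → Set} {xs : List A} (once : EnumeratesOnce _≈_ xs) where

  count-guardedClass : {P : Set} (P? : Dec P) {Q : Pred A 0ℓ} (Q? : Decidable Q) (a : A) →
                       (∀ x → Q x → P × x ≈ a) → (P → ∀ x → x ≈ a → Q x) →
                       count Q? xs ≡ indicator P?
  count-guardedClass (yes p) Q? a Q⇒ ⇒Q = once Q? a (λ x → proj₂ ∘ Q⇒ x) (⇒Q p)
  count-guardedClass (no ¬p) Q? a Q⇒ ⇒Q = count-none Q? (λ x → ¬p ∘ proj₁ ∘ Q⇒ x) xs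

bools-enumerateOnce : EnumeratesOnce _≡_ (true ∷ false ∷ [])
bools-enumerateOnce Q? true  Q⇒ ⇒Q with Q? true
... | no ¬qt = ⊥-elim (¬qt (⇒Q true refl))
... | yes _ with Q? false
...   | no _  = refl
...   | yes qf with () ← Q⇒ false qf
bools-enumerateOnce Q? false Q⇒ ⇒Q with Q? true
... | yes qt with () ← Q⇒ true qt
... | no _ with Q? false
...   | yes _  = refl
...   | no ¬qf = ⊥-elim (¬qf (⇒Q false refl))

∷-pointwise : ∀ {ℓ} (_≈_ : A → A → Set ℓ) {n} {x : A} {f : Vector A n} {g : Vector A (ℕ.suc n)} →
              x ≈ head g → Pointwise _≈_ f (tail g) → Pointwise _≈_ (x VF.∷ f) g
∷-pointwise _ x≈ f≈ zero    = x≈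
∷-pointwise _ x≈ f≈ (suc i) = f≈ i

module _ {A : Set} {_≈_ : A → A → Set} (≈-refl : Reflexive _≈_) where

  allFuns-enumerateOnce : ∀ {xs} → EnumeratesOnce _≈_ xs →
                          ∀ n → EnumeratesOnce (Pointwise _≈_ {n}) (allFuns n xs)
  allFuns-enumerateOnce once ℕ.zero    Q? a Q⇒ ⇒Q = count-singleton Q? (⇒Q _ λ ())
  allFuns-enumerateOnce {xs} once (ℕ.suc n) {Q} Q? a Q⇒ ⇒Q = begin
    count Q? (concatMap (λ x → map (x VF.∷_) (allFuns n xs)) xs)
      ≡⟨ count-concatMap Q? (λ x → map (x VF.∷_) (allFuns n xs)) xs ⟩
    sum (map (λ x → count Q? (map (x VF.∷_) (allFuns n xs))) xs)
      ≡⟨ cong sum (map-cong count-fibre xs) ⟩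
    sum (map (λ x → indicator (Q? (x VF.∷ tail a))) xs)
      ≡⟨ count≡sum-indicator (λ x → Q? (x VF.∷ tail a)) xs ⟨
    count (λ x → Q? (x VF.∷ tail a)) xs
      ≡⟨ once (λ x → Q? (x VF.∷ tail a)) (head a) (λ x q → Q⇒ _ q zero)
              (λ x x≈ → ⇒Q _ (∷-pointwise _≈_ x≈ (λ i → ≈-refl))) ⟩
    1 ∎
    where
    open ≡-Reasoning
    count-fibre : ∀ x → count Q? (map (x VF.∷_) (allFuns n xs))
                        ≡ indicator (Q? (x VF.∷ tail a))
    count-fibre x =
      trans (count-map Q? (x VF.∷_) (allFuns n xs))
            (count-guardedClass {xs = allFuns n xs} (allFuns-enumerateOnce {xs} once n)
               (Q? (x VF.∷ tail a)) (Q? ∘ (x VF.∷_)) (tail a)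
               (λ f q → ⇒Q _ (∷-pointwise _≈_ (Q⇒ _ q zero) (λ i → ≈-refl))
                      , λ i → Q⇒ _ q (suc i))
               (λ q f f≈ → ⇒Q _ (∷-pointwise _≈_ (Q⇒ _ q zero) f≈)))

adjacencies-enumerateOnce : (F : Graph) → EnumeratesOnce (Pointwise (Pointwise _≡_)) (adjacencies F)
adjacencies-enumerateOnce F =
  allFuns-enumerateOnce (λ i → refl)
    (allFuns-enumerateOnce refl bools-enumerateOnce (size F)) (size F)

≡true-equivalent⇒≡ : {x y : Bool} →
                     (x ≡ true → y ≡ true) → (y ≡ true → x ≡ true) → x ≡ y
≡true-equivalent⇒≡ {true}  {true}  _ _ = refl
≡true-equivalent⇒≡ {true}  {false} f _ = sym (f refl)
≡true-equivalent⇒≡ {false} {true}  _ g = g refl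
≡true-equivalent⇒≡ {false} {false} _ _ = refl

Comparable : ∀ {n} → Rel n → Fin n → Fin n → Set
Comparable T u v = (T ⊢ u ⪯ v) ⊎ (T ⊢ v ⪯ u)

Symmetric : ∀ {n} → Rel n → Set
Symmetric E = ∀ u v → E u v ≡ E v u

SupportedOn : ∀ {n} → Rel n → Rel n → Set
SupportedOn T E = ∀ u v → E u v ≡ true → Comparable T u v

module _ {n} {T : Rel n} {E E′ : Rel n} (E-sym : Symmetric E) (E′-sym : Symmetric E′)
         (agree : ∀ u v → T ⊢ u ⪯ v → E u v ≡ E′ u v) where

  agree-comparable : ∀ u v → Comparable T u v → E u v ≡ E′ u v
  agree-comparable u v (inj₁ u⪯v) = agree u v u⪯v
  agree-comparable u v (inj₂ v⪯u) = trans (E-sym u v) (trans (agree v u v⪯u) (E′-sym v u))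

  agree-supportedOn : SupportedOn T E → SupportedOn T E′ → ∀ u v → E u v ≡ E′ u v
  agree-supportedOn E-supp E′-supp u v = ≡true-equivalent⇒≡
    (λ e  → trans (sym (agree-comparable u v (E-supp u v e))) e)
    (λ e′ → trans (agree-comparable u v (E′-supp u v e′)) e′)

-- The edges of the unique supergraph G ⊇ F on which h is past-preserving.
comparableAdjacency : ∀ {n} → Rel n → (H : Graph) → (Fin n → Fin (size H)) → Rel n
comparableAdjacency T H h u v = (T u v ∨ T v u) ∧ adj H (h u) (h v)

module ComparableAdjacency {n} (T : Rel n) {H : Graph} (gH : IsGraph H)
                           (h : Fin n → Fin (size H)) where

  private
    E-h = comparableAdjacency T H h

  comparableAdjacency-sym : Symmetric E-h
  comparableAdjacency-sym u v = cong₂ _∧_ (∨-comm (T u v) (T v u)) (proj₁ gH (h u) (h v))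

  comparableAdjacency-irrefl : ∀ u → E-h u u ≡ false
  comparableAdjacency-irrefl u = trans (cong ((T u u ∨ T u u) ∧_) (proj₂ gH (h u))) (∧-zeroʳ _)

  comparableAdjacency-supportedOn : SupportedOn T E-h
  comparableAdjacency-supportedOn u v e with T u v | T v u
  ... | true  | _    = inj₁ refl
  ... | false | true = inj₂ refl

  comparableAdjacency-comparable : ∀ u v → Comparable T u v → E-h u v ≡ adj H (h u) (h v)
  comparableAdjacency-comparable =
    agree-comparable comparableAdjacency-sym (λ u v → proj₁ gH (h u) (h v))
      (λ u v u⪯v → cong (λ t → (t ∨ T v u) ∧ adj H (h u) (h v)) u⪯v)

module _ (k : ℕ) (F : Graph) (T : Rel (size F)) (H : Graph) (gH : IsGraph H)
         (h : Fin (size F) → Fin (size H)) where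

  private
    E-h = comparableAdjacency T H h
  open ComparableAdjacency T {H} gH h

  pastPreserving⇒comparableAdjacency : ∀ {E} → SupergraphInD k F T E →
                                       IsPastPreserving (withEdges F E) T H h → ∀ u v → E u v ≡ E-h u v
  pastPreserving⇒comparableAdjacency {E} (gE , _ , (_ , E-supp) , _) (_ , preserving) =
    agree-supportedOn (proj₁ gE) comparableAdjacency-sym E≡E-h E-supp comparableAdjacency-supportedOn
    where
    E≡E-h : ∀ u v → T ⊢ u ⪯ v → E u v ≡ E-h u v
    E≡E-h u v u⪯v =
      trans (≡true-equivalent⇒≡ (proj₁ (preserving u v u⪯v)) (proj₂ (preserving u v u⪯v)))
            (sym (comparableAdjacency-comparable u v (inj₁ u⪯v)))

  pastPreserving⇒pastInjective : ∀ {E} → SupergraphInD k F T E →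
                                 IsPastPreserving (withEdges F E) T H h → IsPastInjective F T H h
  pastPreserving⇒pastInjective (_ , F⊆E , _) (((hom , colours) , injective) , _) =
    ((λ u v → hom u v ∘ F⊆E u v) , colours) , injective

  module _ {E : Rel (size F)} (E≡E-h : ∀ u v → E u v ≡ E-h u v)
           (pi : IsPastInjective F T H h) where

    private
      E-supp : SupportedOn T E
      E-supp u v e = comparableAdjacency-supportedOn u v (trans (sym (E≡E-h u v)) e)

      E≡adj : ∀ u v → Comparable T u v → E u v ≡ adj H (h u) (h v)
      E≡adj u v uv = trans (E≡E-h u v) (comparableAdjacency-comparable u v uv)

    pastInjective⇒supergraphInD : InD k F T → SupergraphInD k F T E
    pastInjective⇒supergraphInD ((treeT , F-supp) , heightT) =
      ( ( (λ u v → trans (E≡E-h u v) (trans (comparableAdjacency-sym u v) (sym (E≡E-h v u))))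
        , (λ u → trans (E≡E-h u u) (comparableAdjacency-irrefl u)) )
      , (λ u v e → trans (E≡adj u v (F-supp u v e)) (proj₁ (proj₁ pi) u v e))
      , (treeT , E-supp) , heightT )

    pastInjective⇒pastPreserving : IsPastPreserving (withEdges F E) T H h
    pastInjective⇒pastPreserving =
      ( ((λ u v e → trans (sym (E≡adj u v (E-supp u v e))) e) , proj₂ (proj₁ pi)) , proj₂ pi )
      , λ u v u⪯v → (λ e → trans (sym (E≡adj u v (inj₁ u⪯v))) e)
                  , (λ a → trans (E≡adj u v (inj₁ u⪯v)) a)

  count-pastPreservingSupergraphs : InD k F T →
    count (λ E → supergraphInD? k F T E ×-dec isPastPreserving? (withEdges F E) T H h)
          (adjacencies F)
    ≡ indicator (isPastInjective? F T H h)
  count-pastPreservingSupergraphs inD =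
    count-guardedClass {xs = adjacencies F} (adjacencies-enumerateOnce F) (isPastInjective? F T H h)
      (λ E → supergraphInD? k F T E ×-dec isPastPreserving? (withEdges F E) T H h) E-h
      (λ E (s , pp) → pastPreserving⇒pastInjective s pp , pastPreserving⇒comparableAdjacency s pp)
      (λ pi E E≡E-h → pastInjective⇒supergraphInD E≡E-h pi inD
                    , pastInjective⇒pastPreserving E≡E-h pi)

corollary12 : (k : ℕ) (F : Graph) (T : Rel (size F)) (H : Graph) →
    IsGraph F → IsGraph H → InD k F T →
    pi-hom F T H ≡ sumOverSupergraphs k F T H
corollary12 k F T H _ gH inD = begin
  pi-hom F T H
    ≡⟨ count≡sum-indicator (isPastInjective? F T H) (maps F H) ⟩
  sum (map (indicator ∘ isPastInjective? F T H) (maps F H))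
    ≡⟨ cong sum (map-cong (λ h → count-pastPreservingSupergraphs k F T H gH h inD) (maps F H)) ⟨
  sum (map (λ h → count (λ E → supergraphInD? k F T E ×-dec PP? E h) (adjacencies F)) (maps F H))
    ≡⟨ sum-count-filter (supergraphInD? k F T) PP? (adjacencies F) (maps F H) ⟨
  sumOverSupergraphs k F T H ∎
  where
  open ≡-Reasoning
  PP? : ∀ E → Decidable (IsPastPreserving (withEdges F E) T H)
  PP? E = isPastPreserving? (withEdges F E) T H
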